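{- Let $D$ be a digraph with potential function $\phi$, let $S_{opt}$ be a minimum-size feasible solution for $(D,\phi)$ and let $Z_{opt}$ be the set of sinks of $D-S_{opt}$. If $x\in Z_{opt}$, then $|S_{opt}|=|N^+(x)|+\mathrm{KFVD}(D',\phi')$, where $(D',\phi')=update(D,\phi,x,-)$.
   Context: All digraphs are finite, without loops or parallel arcs; $N^+(v)$ and $N^-(v)$ denote out- and in-neighbourhoods in $D$. A sink is a vertex of out-degree $0$. A knot in a digraph is a strongly connected component of size at least $2$ with no arc leaving it; a digraph is knot-free if it has no knot. A potential function is a map $\phi:V(D)\to\{0.25,1\}$; vertices with $\phi(v)=1$ are undecided, their set is $\mathcal{U}$. A set $S\subseteq V(D)$ is a feasible solution for $(D,\phi)$ if $D-S$ (the subgraph induced on $V(D)\setminus S$) is knot-free and every sink $s$ of $D-S$ satisfies $\phi(s)=1$. $\mathrm{KFVD}(D,\phi)$ denotes the minimum size of a feasible solution for $(D,\phi)$. For $v\in V(D)$, $R^-(v)$ is the set of vertices having a directed path to $v$ in $D-N^+(v)$ (so $v\in R^-(v)$), $R(v)=N^+(v)\cup R^-(v)$, and $R^+(v)=\{u\in\mathcal{U}: v\in R^-(u)\}$. For a vertex $s$, $update(D,\phi,s,-)$ returns $(D',\phi')$ where $D'=D-R(s)$ and $\phi'$ is defined on $V(D')$ by $\phi'(v)=0.25$ if $v\in R^+(s)$ and $\phi'(v)=\phi(v)$ otherwise. -}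

module Defs where

open import Data.Nat using (ℕ; _≤_; _+_)
open import Data.Bool using (Bool; true; false)
open import Data.Fin using (Fin)
open import Data.Fin.Subset using (Subset; _∈_; _∉_; ∣_∣)
open import Data.Vec using (tabulate)
open import Data.Product using (Σ; _×_; _,_)
open import Data.Sum using (_⊎_)
open import Relation.Nullary using (¬_)
open import Relation.Binary.PropositionalEquality using (_≡_)

-- A finite digraph on vertex set Fin n: no loops; parallel arcs impossible
-- since the arc relation is a Boolean adjacency function.
record Digraph (n : ℕ) : Set where
  field
    adj   : Fin n → Fin n → Bool
    noLoop : ∀ v → adj v v ≡ false
open Digraph public

module _ {n : ℕ} (D : Digraph n) where

  Arc : Fin n → Fin n → Set
  Arc u v = adj D u v ≡ true

  N⁺ : Fin n → Subset n
  N⁺ v = tabulate (adj D v)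

  -- Vertex sets W ⊆ V(D) (as predicates); D[W] is the induced subgraph.
  VSet : Set₁
  VSet = Fin n → Set

  _∖_ : VSet → Subset n → VSet
  (W ∖ S) v = W v × v ∉ S

  data Reach (W : VSet) : Fin n → Fin n → Set where
    here : ∀ {u} → W u → Reach W u u
    step : ∀ {u w v} → W u → Arc u w → Reach W w v → Reach W u v

  record IsKnot (W : VSet) (K : Subset n) : Set where
    field
      inside    : ∀ u → u ∈ K → W u
      strong    : ∀ u v → u ∈ K → v ∈ K → Reach W u v
      maximal   : ∀ u v → u ∈ K → W v → Reach W u v → Reach W v u → v ∈ K
      size≥2    : 2 ≤ ∣ K ∣
      noLeaving : ∀ u v → u ∈ K → W v → Arc u v → v ∈ K

  KnotFree : VSet → Set
  KnotFree W = ∀ (K : Subset n) → ¬ IsKnot W K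

  IsSink : VSet → Fin n → Set
  IsSink W s = W s × (∀ v → W v → ¬ Arc s v)

  -- Feasible solution for (D[W], φ) where U is the set of undecided
  -- vertices (those with φ = 1).
  record Feasible (W : VSet) (U : VSet) (S : Subset n) : Set where
    field
      subset   : ∀ v → v ∈ S → W v
      knotFree : KnotFree (W ∖ S)
      sinksU   : ∀ s → IsSink (W ∖ S) s → U s

  IsKFVD : VSet → VSet → ℕ → Set
  IsKFVD W U k =
    Σ (Subset n) (λ S → Feasible W U S × ∣ S ∣ ≡ k)
    × (∀ S → Feasible W U S → k ≤ ∣ S ∣)

  R⁻ : Fin n → VSet
  R⁻ v u = Reach (λ w → w ∉ N⁺ v) u v

  R : Fin n → VSet
  R v u = u ∈ N⁺ v ⊎ R⁻ v u

data Pot : Set where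
  p0·25 p1 : Pot

module _ {n : ℕ} (D : Digraph n) where

  AllV : VSet D
  AllV _ = Fin n

  Undecided : (Fin n → Pot) → VSet D
  Undecided φ v = φ v ≡ p1

  R⁺ : (Fin n → Pot) → Fin n → VSet D
  R⁺ φ v u = φ u ≡ p1 × R⁻ D u v

  Feasible₀ : (Fin n → Pot) → Subset n → Set
  Feasible₀ φ S = Feasible D AllV (Undecided φ) S

  MinFeasible : (Fin n → Pot) → Subset n → Set
  MinFeasible φ S = Feasible₀ φ S × (∀ S' → Feasible₀ φ S' → ∣ S ∣ ≤ ∣ S' ∣)

  -- update(D, φ, s, -) = (D', φ'): D' = D - R(s) (as vertex set of D),
  -- and the undecided vertices of φ' are those v ∈ V(D') with
  -- φ v = 1 and v ∉ R⁺(s).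
  update-V : Fin n → VSet D
  update-V s v = ¬ R D s v

  update-U : (Fin n → Pot) → Fin n → VSet D
  update-U φ s v = φ v ≡ p1 × ¬ R⁺ φ s v

module Submission where

-- Since x is a sink of D − S, N⁺(x) ⊆ S. By minimality of S, no vertex of R⁻(s) lies in S
-- whenever s is a sink of D − S: the last vertex of S on a path towards s could be dropped.
-- Consequently S ─ N⁺(x) is feasible for update(D, φ, x, −), and conversely N⁺(x) ∪ S′ is
-- feasible for (D, φ) whenever S′ is feasible for the update; comparing sizes gives the claim.

open import Defs
open import Data.Nat using (ℕ; suc; _+_; _≤_)
open import Data.Nat.Properties using (+-suc; +-cancelˡ-≤; <⇒≱)
open import Data.Fin using (Fin)
open import Data.Fin.Properties using (_≟_)
open import Data.Fin.Subset
  using (Subset; _∈_; _∉_; _⊆_; _∪_; _─_; _-_; ⁅_⁆; ∣_∣)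
open import Data.Fin.Subset.Properties
  using ( _∈?_; nonempty?; x∈⁅x⁆; ∣⁅x⁆∣≡1; p⊆q⇒∣p∣≤∣q∣; ⊆-antisym
        ; x∈p∪q⁻; x∈p∪q⁺; p─q⊆p; x∈p∧x∉q⇒x∈p─q; x∈p∧x≢y⇒x∈p-y; x∈p⇒∣p-x∣<∣p∣ )
open import Data.Bool using (true; false)
open import Data.Vec using ([]; _∷_; here; there)
open import Data.Vec.Properties using ([]=⇒lookup; lookup⇒[]=; lookup∘tabulate)
open import Data.Product using (Σ; _×_; _,_; proj₁; proj₂)
open import Data.Sum using (_⊎_; inj₁; inj₂)
open import Data.Empty using (⊥-elim)
open import Function using (_∘_)
open import Relation.Nullary using (¬_; yes; no; contradiction)
open import Relation.Unary using () renaming (_⊆_ to _⊆ᵥ_)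
open import Relation.Binary.PropositionalEquality
  using (_≡_; _≢_; refl; sym; trans; cong; subst; subst₂)
open IsKnot
open Feasible

x∈p─q⇒x∉q : ∀ {n} {x : Fin n} (p q : Subset n) → x ∈ p ─ q → x ∉ q
x∈p─q⇒x∉q (_ ∷ _) (true ∷ _) ()            here
x∈p─q⇒x∉q (_ ∷ p) (_ ∷ q)    (there x∈p─q) (there x∈q) = x∈p─q⇒x∉q p q x∈p─q x∈q

x∉p-y∧x≢y⇒x∉p : ∀ {n} {x y : Fin n} {p : Subset n} → x ∉ p - y → x ≢ y → x ∉ p
x∉p-y∧x≢y⇒x∉p x∉p-y x≢y x∈p = x∉p-y (x∈p∧x≢y⇒x∈p-y x∈p x≢y)

∣p∪q∣≡∣p∣+∣q∣ : ∀ {n} (p q : Subset n) → (∀ {x} → x ∈ p → x ∉ q) → ∣ p ∪ q ∣ ≡ ∣ p ∣ + ∣ q ∣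
∣p∪q∣≡∣p∣+∣q∣ []          []          _        = refl
∣p∪q∣≡∣p∣+∣q∣ (true ∷ p)  (true ∷ q)  disjoint = contradiction here (disjoint here)
∣p∪q∣≡∣p∣+∣q∣ (true ∷ p)  (false ∷ q) disjoint =
  cong suc (∣p∪q∣≡∣p∣+∣q∣ p q (λ x∈p x∈q → disjoint (there x∈p) (there x∈q)))
∣p∪q∣≡∣p∣+∣q∣ (false ∷ p) (true ∷ q)  disjoint =
  trans (cong suc (∣p∪q∣≡∣p∣+∣q∣ p q (λ x∈p x∈q → disjoint (there x∈p) (there x∈q))))
        (sym (+-suc ∣ p ∣ ∣ q ∣))
∣p∪q∣≡∣p∣+∣q∣ (false ∷ p) (false ∷ q) disjoint =
  ∣p∪q∣≡∣p∣+∣q∣ p q (λ x∈p x∈q → disjoint (there x∈p) (there x∈q))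

module _ {n : ℕ} {p q : Subset n} where

  q⊆p⇒p≡q∪p─q : q ⊆ p → p ≡ q ∪ (p ─ q)
  q⊆p⇒p≡q∪p─q q⊆p = ⊆-antisym p⊆q∪p─q q∪p─q⊆p
    where
    p⊆q∪p─q : p ⊆ q ∪ (p ─ q)
    p⊆q∪p─q {x} x∈p with x ∈? q
    ... | yes x∈q = x∈p∪q⁺ (inj₁ x∈q)
    ... | no x∉q = x∈p∪q⁺ (inj₂ (x∈p∧x∉q⇒x∈p─q x∈p x∉q))
    q∪p─q⊆p : q ∪ (p ─ q) ⊆ p
    q∪p─q⊆p x∈ with x∈p∪q⁻ q (p ─ q) x∈
    ... | inj₁ x∈q = q⊆p x∈q
    ... | inj₂ x∈p─q = p─q⊆p p q x∈p─q

  q⊆p⇒∣p∣≡∣q∣+∣p─q∣ : q ⊆ p → ∣ p ∣ ≡ ∣ q ∣ + ∣ p ─ q ∣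
  q⊆p⇒∣p∣≡∣q∣+∣p─q∣ q⊆p = trans (cong ∣_∣ (q⊆p⇒p≡q∪p─q q⊆p))
    (∣p∪q∣≡∣p∣+∣q∣ q (p ─ q) (λ x∈q x∈p─q → x∈p─q⇒x∉q p q x∈p─q x∈q))

module Graph {n : ℕ} (D : Digraph n) where

  infixl 5 _⊖_
  _⊖_ : VSet D → Subset n → VSet D
  W ⊖ S = _∖_ D W S

  ⊖-antitone : ∀ {W S T} → S ⊆ T → W ⊖ T ⊆ᵥ W ⊖ S
  ⊖-antitone S⊆T (Wv , v∉T) = Wv , v∉T ∘ S⊆T

  Arc⇒∈N⁺ : ∀ {s u} → Arc D s u → u ∈ N⁺ D s
  Arc⇒∈N⁺ {s} {u} arc = lookup⇒[]= u (N⁺ D s) (trans (lookup∘tabulate (adj D s) u) arc)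

  ∈N⁺⇒Arc : ∀ {s u} → u ∈ N⁺ D s → Arc D s u
  ∈N⁺⇒Arc {s} {u} u∈N⁺ = trans (sym (lookup∘tabulate (adj D s) u)) ([]=⇒lookup u∈N⁺)

  ∉N⁺-self : ∀ s → s ∉ N⁺ D s
  ∉N⁺-self s s∈N⁺ with trans (sym (∈N⁺⇒Arc s∈N⁺)) (noLoop D s)
  ... | ()

  Reach-start : ∀ {W a b} → Reach D W a b → W a
  Reach-start (here Wa)     = Wa
  Reach-start (step Wa _ _) = Wa

  Reach-end : ∀ {W a b} → Reach D W a b → W b
  Reach-end (here Wb)    = Wb
  Reach-end (step _ _ r) = Reach-end r

  Reach-mono : ∀ {W V a b} → W ⊆ᵥ V → Reach D W a b → Reach D V a b
  Reach-mono W⊆V (here Wa)       = here (W⊆V Wa)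
  Reach-mono W⊆V (step Wa arc r) = step (W⊆V Wa) arc (Reach-mono W⊆V r)

  Reach-lift : ∀ {W V a b} → (∀ {y} → Reach D W y b → V y) → Reach D W a b → Reach D V a b
  Reach-lift f (here Wa)       = here (f (here Wa))
  Reach-lift f (step Wa arc r) = step (f (step Wa arc r)) arc (Reach-lift f r)

  OutClosed : VSet D → VSet D → Set
  OutClosed W V = ∀ {u v} → W u → Arc D u v → V v → W v

  Reach-closed : ∀ {W V a b} → OutClosed W V → W a → Reach D V a b → Reach D W a b
  Reach-closed closed Wa (here _)      = here Wa
  Reach-closed closed Wa (step _ arc r) =
    step Wa arc (Reach-closed closed (closed Wa arc (Reach-start r)) r)

  sink⇒N⁺⊆S : ∀ {S s} → IsSink D (AllV D ⊖ S) s → N⁺ D s ⊆ S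
  sink⇒N⁺⊆S {S} (_ , noArc) {t} t∈N⁺ with t ∈? S
  ... | yes t∈S = t∈S
  ... | no t∉S = ⊥-elim (noArc t (t , t∉S) (∈N⁺⇒Arc t∈N⁺))

  sink-reach⇒≡ : ∀ {W s v} → IsSink D W s → Reach D W s v → s ≡ v
  sink-reach⇒≡ _             (here _)       = refl
  sink-reach⇒≡ (_ , noArc) (step _ arc r) = ⊥-elim (noArc _ (Reach-start r) arc)

  sink-restrict : ∀ {W V s} → W ⊆ᵥ V → W s → IsSink D V s → IsSink D W s
  sink-restrict W⊆V Ws (_ , noArc) = Ws , λ v Wv → noArc v (W⊆V Wv)

  sink-extend : ∀ {W V s} → W ⊆ᵥ V → OutClosed W V → IsSink D W s → IsSink D V s
  sink-extend W⊆V closed (Ws , noArc) =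
    W⊆V Ws , λ v Vv arc → noArc v (closed Ws arc Vv) arc

  sink-⊖-remove : ∀ {W S s u} → IsSink D (W ⊖ S) s → u ∉ N⁺ D s → IsSink D (W ⊖ (S - u)) s
  sink-⊖-remove {W} {S} {s} {u} sink u∉N⁺ =
    ⊖-antitone {W} (p─q⊆p S ⁅ u ⁆) (proj₁ sink) , noArc
    where
    noArc : ∀ v → (W ⊖ (S - u)) v → ¬ Arc D s v
    noArc v (Wv , v∉S-u) arc with v ≟ u
    ... | yes refl = u∉N⁺ (Arc⇒∈N⁺ arc)
    ... | no v≢u = proj₂ sink v (Wv , x∉p-y∧x≢y⇒x∉p v∉S-u v≢u) arc

  knot-path : ∀ {W K a b} → IsKnot D W K → a ∈ K → Reach D W a b → Reach D (_∈ K) a b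
  knot-path kn a∈K (here _)       = here a∈K
  knot-path kn a∈K (step _ arc r) =
    step a∈K arc (knot-path kn (noLeaving kn _ _ a∈K (Reach-start r) arc) r)

  knot-¬sink : ∀ {W K s} → IsKnot D W K → s ∈ K → ¬ IsSink D W s
  knot-¬sink {K = K} {s} kn s∈K (_ , noArc) with nonempty? (K - s)
  ... | yes (t , t∈K-s) with strong kn s t s∈K (p─q⊆p K ⁅ s ⁆ t∈K-s)
  ...   | here _       = x∈p─q⇒x∉q K ⁅ s ⁆ t∈K-s (x∈⁅x⁆ s)
  ...   | step _ arc r = noArc _ (Reach-start r) arc
  knot-¬sink {K = K} {s} kn s∈K _ | no K-s-empty =
    <⇒≱ (size≥2 kn) (subst (∣ K ∣ ≤_) (∣⁅x⁆∣≡1 s) (p⊆q⇒∣p∣≤∣q∣ K⊆⁅s⁆))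
    where
    K⊆⁅s⁆ : K ⊆ ⁅ s ⁆
    K⊆⁅s⁆ {t} t∈K with t ≟ s
    ... | yes refl = x∈⁅x⁆ s
    ... | no t≢s = contradiction (t , x∈p∧x≢y⇒x∈p-y t∈K t≢s) K-s-empty

  knot-¬reach-sink : ∀ {W K u s} → IsKnot D W K → u ∈ K → Reach D W u s → ¬ IsSink D W s
  knot-¬reach-sink kn u∈K r = knot-¬sink kn (Reach-end (knot-path kn u∈K r))

  knot-restrict : ∀ {W V K} → W ⊆ᵥ V → (∀ {u} → u ∈ K → W u) → IsKnot D V K → IsKnot D W K
  knot-restrict W⊆V K⊆W kn = record
    { inside    = λ _ → K⊆W
    ; strong    = λ a b a∈K b∈K → Reach-mono K⊆W (knot-path kn a∈K (strong kn a b a∈K b∈K))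
    ; maximal   = λ a v a∈K Wv r₁ r₂ →
        maximal kn a v a∈K (W⊆V Wv) (Reach-mono W⊆V r₁) (Reach-mono W⊆V r₂)
    ; size≥2    = size≥2 kn
    ; noLeaving = λ a v a∈K Wv arc → noLeaving kn a v a∈K (W⊆V Wv) arc
    }

  knot-extend : ∀ {W V K} → W ⊆ᵥ V → OutClosed W V → IsKnot D W K → IsKnot D V K
  knot-extend W⊆V closed kn = record
    { inside    = λ u u∈K → W⊆V (inside kn u u∈K)
    ; strong    = λ a b a∈K b∈K → Reach-mono W⊆V (strong kn a b a∈K b∈K)
    ; maximal   = λ a v a∈K _ r₁ r₂ →
        let r₁ᵂ = Reach-closed closed (inside kn a a∈K) r₁
        in maximal kn a v a∈K (Reach-end r₁ᵂ) r₁ᵂ (Reach-closed closed (Reach-end r₁ᵂ) r₂)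
    ; size≥2    = size≥2 kn
    ; noLeaving = λ a v a∈K Vv arc → noLeaving kn a v a∈K (closed (inside kn a a∈K) arc Vv) arc
    }

  record ExitFrom (W : VSet D) (S : Subset n) (b : Fin n) : Set where
    constructor exit
    field
      {source target} : Fin n
      source∈S  : source ∈ S
      W-source  : W source
      exit-arc  : Arc D source target
      exit-path : Reach D (W ⊖ S) target b

  Reach-avoid-or-exit : ∀ {W S a b} → b ∉ S → Reach D W a b → Reach D (W ⊖ S) a b ⊎ ExitFrom W S b
  Reach-avoid-or-exit b∉S (here Wb) = inj₁ (here (Wb , b∉S))
  Reach-avoid-or-exit {S = S} {a} b∉S (step Wa arc r) with Reach-avoid-or-exit b∉S r
  ... | inj₂ e = inj₂ e
  ... | inj₁ rˢ with a ∈? S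
  ...   | yes a∈S = inj₂ (exit a∈S Wa arc rˢ)
  ...   | no a∉S = inj₁ (step (Wa , a∉S) arc rˢ)

  -- A knot through u would reach the sink s, and u is no sink because of its arc to w.
  feasible-remove : ∀ {W U S u w s} → Feasible D W U S → u ∈ S → Arc D u w
    → Reach D (W ⊖ (S - u)) w s → IsSink D (W ⊖ (S - u)) s → Feasible D W U (S - u)
  feasible-remove {W} {U} {S} {u} feas u∈S arc r sink = record
    { subset = λ v v∈S-u → subset feas v (p─q⊆p S ⁅ u ⁆ v∈S-u)
    ; knotFree = knotFree-removed
    ; sinksU = sinksU-removed
    }
    where
    ⊖S⊆⊖S-u : W ⊖ S ⊆ᵥ W ⊖ (S - u)
    ⊖S⊆⊖S-u = ⊖-antitone {W} (p─q⊆p S ⁅ u ⁆)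

    ⊖S-u⊆⊖S : ∀ {v} → (W ⊖ (S - u)) v → v ≢ u → (W ⊖ S) v
    ⊖S-u⊆⊖S (Wv , v∉S-u) v≢u = Wv , x∉p-y∧x≢y⇒x∉p v∉S-u v≢u

    u∉S-u : u ∉ S - u
    u∉S-u u∈S-u = x∈p─q⇒x∉q S ⁅ u ⁆ u∈S-u (x∈⁅x⁆ u)

    knotFree-removed : KnotFree D (W ⊖ (S - u))
    knotFree-removed K kn with u ∈? K
    ... | yes u∈K = knot-¬reach-sink kn u∈K (step (subset feas u u∈S , u∉S-u) arc r) sink
    ... | no u∉K = knotFree feas K (knot-restrict ⊖S⊆⊖S-u K⊆⊖S kn)
      where
      K⊆⊖S : ∀ {t} → t ∈ K → (W ⊖ S) t
      K⊆⊖S {t} t∈K = ⊖S-u⊆⊖S (inside kn t t∈K) (λ { refl → u∉K t∈K })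

    sinksU-removed : ∀ t → IsSink D (W ⊖ (S - u)) t → U t
    sinksU-removed t sinkᵗ with t ≟ u
    ... | yes refl = ⊥-elim (proj₂ sinkᵗ _ (Reach-start r) arc)
    ... | no t≢u = sinksU feas t (sink-restrict ⊖S⊆⊖S-u (⊖S-u⊆⊖S (proj₁ sinkᵗ) t≢u) sinkᵗ)

module _ {n : ℕ} (D : Digraph n) (φ : Fin n → Pot) {S : Subset n} (opt : MinFeasible D φ S) where

  open Graph D

  private
    feas : Feasible₀ D φ S
    feas = proj₁ opt

  R⁻-sink-∉ : ∀ {s v} → IsSink D (AllV D ⊖ S) s → R⁻ D s v → v ∉ S
  R⁻-sink-∉ {s} sink r v∈S with Reach-avoid-or-exit (proj₂ (proj₁ sink)) r
  ... | inj₁ rˢ = proj₂ (Reach-start rˢ) v∈S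
  ... | inj₂ (exit {u} u∈S u∉N⁺ arc rˢ) =
    <⇒≱ (x∈p⇒∣p-x∣<∣p∣ u∈S) (proj₂ opt (S - u) smaller)
    where
    smaller : Feasible₀ D φ (S - u)
    smaller = feasible-remove feas u∈S arc
      (Reach-mono (λ {v} (_ , v∉S) → ⊖-antitone (p─q⊆p S ⁅ u ⁆) (v , v∉S)) rˢ)
      (sink-⊖-remove sink u∉N⁺)

  module _ {x : Fin n} (sink : IsSink D (AllV D ⊖ S) x) where

    N⁺⊆S : N⁺ D x ⊆ S
    N⁺⊆S = sink⇒N⁺⊆S sink

    update-feasible : Feasible D (update-V D x) (update-U D φ x) (S ─ N⁺ D x)
    update-feasible = record
      { subset   = λ t t∈T → ¬R-T t∈T
      ; knotFree = λ K kn → knotFree feas K (knot-extend ⊖T⊆⊖S closed kn)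
      ; sinksU   = λ t sinkᵗ → undecided t sinkᵗ
      }
      where
      T = S ─ N⁺ D x

      ¬R-T : ∀ {t} → t ∈ T → ¬ R D x t
      ¬R-T t∈T (inj₁ t∈N⁺) = x∈p─q⇒x∉q S (N⁺ D x) t∈T t∈N⁺
      ¬R-T t∈T (inj₂ r) = R⁻-sink-∉ sink r (p─q⊆p S (N⁺ D x) t∈T)

      ⊖T⊆⊖S : update-V D x ⊖ T ⊆ᵥ AllV D ⊖ S
      ⊖T⊆⊖S {v} (¬Rv , v∉T) = v , λ v∈S → v∉T (x∈p∧x∉q⇒x∈p─q v∈S (¬Rv ∘ inj₁))

      closed : OutClosed (update-V D x ⊖ T) (AllV D ⊖ S)
      closed {u} {v} (¬Ru , _) arc (_ , v∉S) = ¬Rv , v∉S ∘ p─q⊆p S (N⁺ D x)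
        where
        ¬Rv : ¬ R D x v
        ¬Rv (inj₁ v∈N⁺) = v∉S (N⁺⊆S v∈N⁺)
        ¬Rv (inj₂ r) = ¬Ru (inj₂ (step (¬Ru ∘ inj₁) arc r))

      -- A path from x to t avoiding N⁺(t) misses S, so the sink x would have to be t.
      undecided : ∀ t → IsSink D (update-V D x ⊖ T) t → update-U D φ x t
      undecided t sinkᵗ = sinksU feas t sinkˢ , ¬R⁺
        where
        sinkˢ = sink-extend ⊖T⊆⊖S closed sinkᵗ
        ¬R⁺ : ¬ R⁺ D φ x t
        ¬R⁺ (_ , r) = proj₁ (proj₁ sinkᵗ)
          (subst (R D x) (sink-reach⇒≡ sink (Reach-lift (λ {y} rʸ → y , R⁻-sink-∉ sinkˢ rʸ) r))
                 (inj₂ (here (∉N⁺-self x))))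

    extend-feasible : ∀ {S′} → Feasible D (update-V D x) (update-U D φ x) S′
      → Feasible₀ D φ (N⁺ D x ∪ S′)
    extend-feasible {S′} feas′ = record
      { subset   = λ v _ → v
      ; knotFree = λ K kn → knotFree feas′ K (knot-restrict ⊖S′⊆⊖S* (K⊆⊖S′ kn) kn)
      ; sinksU   = undecided
      }
      where
      S* = N⁺ D x ∪ S′
      W* = AllV D ⊖ S*

      ∉S* : ∀ {v} → v ∉ N⁺ D x → v ∉ S′ → v ∉ S*
      ∉S* v∉N⁺ v∉S′ v∈S* with x∈p∪q⁻ (N⁺ D x) S′ v∈S*
      ... | inj₁ v∈N⁺ = v∉N⁺ v∈N⁺
      ... | inj₂ v∈S′ = v∉S′ v∈S′

      R⁻⊆⊖S* : R⁻ D x ⊆ᵥ W*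
      R⁻⊆⊖S* {v} r = v , ∉S* (Reach-start r) (λ v∈S′ → subset feas′ v v∈S′ (inj₂ r))

      ⊖S′⊆⊖S* : update-V D x ⊖ S′ ⊆ᵥ W*
      ⊖S′⊆⊖S* {v} (¬Rv , v∉S′) = v , ∉S* (¬Rv ∘ inj₁) v∉S′

      sink* : IsSink D W* x
      sink* = R⁻⊆⊖S* (here (∉N⁺-self x)) ,
              λ v (_ , v∉S*) arc → v∉S* (x∈p∪q⁺ (inj₁ (Arc⇒∈N⁺ arc)))

      ¬R : ∀ {t} → W* t → ¬ Reach D W* t x → ¬ R D x t
      ¬R (_ , t∉S*) _ (inj₁ t∈N⁺) = t∉S* (x∈p∪q⁺ (inj₁ t∈N⁺))
      ¬R _ ¬reach (inj₂ r) = ¬reach (Reach-lift R⁻⊆⊖S* r)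

      K⊆⊖S′ : ∀ {K} → IsKnot D W* K → ∀ {t} → t ∈ K → (update-V D x ⊖ S′) t
      K⊆⊖S′ kn {t} t∈K =
        ¬R (inside kn t t∈K) (λ r → knot-¬reach-sink kn t∈K r sink*) ,
        λ t∈S′ → proj₂ (inside kn t t∈K) (x∈p∪q⁺ (inj₂ t∈S′))

      undecided : ∀ t → IsSink D W* t → φ t ≡ p1
      undecided t sinkᵗ with t ≟ x
      ... | yes refl = sinksU feas x sink
      ... | no t≢x = proj₁ (sinksU feas′ t (sink-restrict ⊖S′⊆⊖S* t∈⊖S′ sinkᵗ))
        where
        t∈⊖S′ : (update-V D x ⊖ S′) t
        t∈⊖S′ = ¬R (proj₁ sinkᵗ) (t≢x ∘ sink-reach⇒≡ sinkᵗ) ,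
               λ t∈S′ → proj₂ (proj₁ sinkᵗ) (x∈p∪q⁺ (inj₂ t∈S′))

    ∣S∣≡∣N⁺∣+∣S─N⁺∣ : ∣ S ∣ ≡ ∣ N⁺ D x ∣ + ∣ S ─ N⁺ D x ∣
    ∣S∣≡∣N⁺∣+∣S─N⁺∣ = q⊆p⇒∣p∣≡∣q∣+∣p─q∣ N⁺⊆S

    update-minimal : ∀ S′ → Feasible D (update-V D x) (update-U D φ x) S′ → ∣ S ─ N⁺ D x ∣ ≤ ∣ S′ ∣
    update-minimal S′ feas′ = +-cancelˡ-≤ ∣ N⁺ D x ∣ _ _
      (subst₂ _≤_ ∣S∣≡∣N⁺∣+∣S─N⁺∣ (∣p∪q∣≡∣p∣+∣q∣ (N⁺ D x) S′ disjoint)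
        (proj₂ opt _ (extend-feasible feas′)))
      where
      disjoint : ∀ {v} → v ∈ N⁺ D x → v ∉ S′
      disjoint {v} v∈N⁺ v∈S′ = subset feas′ v v∈S′ (inj₁ v∈N⁺)

corollary2 : ∀ (n : ℕ) (D : Digraph n) (φ : Fin n → Pot) (Sopt : Subset n)
    → MinFeasible D φ Sopt
    → (x : Fin n) → IsSink D (_∖_ D (AllV D) Sopt) x
    → Σ ℕ (λ k → IsKFVD D (update-V D x) (update-U D φ x) k
                × ∣ Sopt ∣ ≡ ∣ N⁺ D x ∣ + k)
corollary2 n D φ Sopt opt x sink =
  ∣ Sopt ─ N⁺ D x ∣ ,
  ((Sopt ─ N⁺ D x , update-feasible D φ opt sink , refl) , update-minimal D φ opt sink) ,
  ∣S∣≡∣N⁺∣+∣S─N⁺∣ D φ opt sink
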